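{- Let $N$ and $v$ be integers with $2\le v\le N+1$. Then (1) $\mathrm{LAK}_{(1,\bar1)}(N,v)=\mathrm{LAK}_{(1,1)}(N,v)$ if $v\ge3$, and $\mathrm{LAK}_{(1,\bar1)}(N,2)=2^{N-1}-1$; (2) $\mathrm{LAK}_{(\bar1,\bar1)}(N,v)=\mathrm{LAK}_{(\bar1,1)}(N,v)$ when $v\le N$.
   Context: Let $A$ be an $N\times k$ array with entries in each column from a $v$-element symbol set. A 1-way interaction is a set $\{(\gamma,\sigma)\}$ with $\gamma$ a column and $\sigma$ a symbol, with $\rho_A(\{(\gamma,\sigma)\})=\{r:A_{r\gamma}=\sigma\}$; the 0-way interaction $\sqcup$ is the empty set of (column, symbol) pairs, with $\rho_A(\sqcup)=\{1,\dots,N\}$. Let $\mathcal I_1$ be the set of 1-way interactions and $\overline{\mathcal I_1}=\mathcal I_1\cup\{\sqcup\}$. For a set $\mathcal T$ of interactions, $\rho_A(\mathcal T)=\bigcup_{T\in\mathcal T}\rho_A(T)$ (so the empty set of interactions has $\rho_A=\emptyset$). A set $\mathcal T\subseteq\overline{\mathcal I_1}$ is independent if there are no $T,T'\in\mathcal T$ with $T\subsetneq T'$. $A$ is a $(1,1)$-LA if $\rho_A(\mathcal T_1)=\rho_A(\mathcal T_2)\iff\mathcal T_1=\mathcal T_2$ for all $\mathcal T_1,\mathcal T_2\subseteq\mathcal I_1$ with $|\mathcal T_1|=|\mathcal T_2|=1$; a $(\bar1,1)$-LA if this holds for all $\mathcal T_1,\mathcal T_2\subseteq\mathcal I_1$ of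 size at most $1$; a $(1,\bar1)$-LA if it holds for all independent $\mathcal T_1,\mathcal T_2\subseteq\overline{\mathcal I_1}$ of size exactly $1$; a $(\bar1,\bar1)$-LA if it holds for all independent $\mathcal T_1,\mathcal T_2\subseteq\overline{\mathcal I_1}$ of size at most $1$. For each variant $X\in\{(1,1),(\bar1,1),(1,\bar1),(\bar1,\bar1)\}$, $\mathrm{LAK}_X(N,v)$ is the largest $k$ such that an $X$-locating array with $N$ rows, $k$ columns and $v$ symbols exists. -}

module Defs where

open import Data.Nat using (ℕ; _≤_)
open import Data.Fin using (Fin)
open import Data.Maybe using (Maybe; just; nothing)
open import Data.Product using (Σ; _×_)
open import Data.Unit using (⊤)
open import Data.Empty using (⊥)
open import Relation.Binary.PropositionalEquality using (_≡_)

Array : ℕ → ℕ → ℕ → Set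
Array N k v = Fin N → Fin k → Fin v

OneWay : ℕ → ℕ → Set
OneWay k v = Fin k × Fin v

-- An element of \overline{I_1}: either the 0-way interaction ⊔ (nothing)
-- or a 1-way interaction (just (γ,σ)).
Interaction : ℕ → ℕ → Set
Interaction k v = Maybe (OneWay k v)

RowSet : ℕ → Set₁
RowSet N = Fin N → Set

∅ʳ : ∀ {N} → RowSet N
∅ʳ _ = ⊥

allʳ : ∀ {N} → RowSet N
allʳ _ = ⊤

SameRows : ∀ {N} → RowSet N → RowSet N → Set
SameRows P Q = ∀ r → (P r → Q r) × (Q r → P r)

ρ₁ : ∀ {N k v} → Array N k v → OneWay k v → RowSet N
ρ₁ A (γ Data.Product., σ) r = A r γ ≡ σ

ρI : ∀ {N k v} → Array N k v → Interaction k v → RowSet N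
ρI A nothing  = allʳ
ρI A (just t) = ρ₁ A t

data Variant : Set where
  v11 vb1 v1b vbb : Variant

-- Candidate sets of interactions 𝒯 for each variant:
--  (1,1):  sets ⊆ I_1 of size exactly 1           ~ a 1-way interaction
--  (1̄,1):  sets ⊆ I_1 of size ≤ 1                 ~ nothing = ∅, just t = {t}
--  (1,1̄):  (independent) sets ⊆ \overline{I_1} of size exactly 1 ~ an element of \overline{I_1}
--  (1̄,1̄):  (independent) sets ⊆ \overline{I_1} of size ≤ 1       ~ nothing = ∅, just T = {T}
-- (Sets of size ≤ 1 are automatically independent.)
Cand : Variant → ℕ → ℕ → Set
Cand v11 k v = OneWay k v
Cand vb1 k v = Maybe (OneWay k v)
Cand v1b k v = Interaction k v
Cand vbb k v = Maybe (Interaction k v)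

-- ρ_A(𝒯) = union of ρ_A(T) over T ∈ 𝒯 (empty set of interactions ↦ ∅).
ρC : ∀ {N k v} (X : Variant) → Array N k v → Cand X k v → RowSet N
ρC v11 A t        = ρ₁ A t
ρC vb1 A nothing  = ∅ʳ
ρC vb1 A (just t) = ρ₁ A t
ρC v1b A T        = ρI A T
ρC vbb A nothing  = ∅ʳ
ρC vbb A (just T) = ρI A T

IsLA : ∀ {N k v} → Variant → Array N k v → Set
IsLA {N} {k} {v} X A =
  (𝒯₁ 𝒯₂ : Cand X k v) →
  (SameRows (ρC X A 𝒯₁) (ρC X A 𝒯₂) → 𝒯₁ ≡ 𝒯₂) × (𝒯₁ ≡ 𝒯₂ → SameRows (ρC X A 𝒯₁) (ρC X A 𝒯₂))

LAExists : Variant → ℕ → ℕ → ℕ → Set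
LAExists X N k v = Σ (Array N k v) (IsLA X)

IsLAK : Variant → ℕ → ℕ → ℕ → Set
IsLAK X N v k = LAExists X N k v × (∀ k′ → LAExists X N k′ v → k′ ≤ k)

-- Every variant locates the 1-way interactions, so the variants differ only in
-- whether ⊔ (all rows) and ∅ (no rows) are also separated from them. A column
-- constant on σ makes ρ(γ,σ) = ρ(⊔) and ρ(γ,σ′) = ∅ for every σ′ ≠ σ. With three
-- symbols two such empty sets would coincide, so a (1,1)-LA has no constant
-- column and is already a (1,1̄)-LA; likewise a (1̄,1)-LA with two symbols has no
-- constant column, and with at least one row it is a (1̄,1̄)-LA. Hence these
-- pairs of variants have the same arrays and the same LAK, which exists since
-- LA-ness is decidable and k ≤ v^N.
-- For v = 2, the rows on which a column of a (1,1̄)-LA agrees with its first entry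
-- form a pattern on the remaining N - 1 rows; these patterns are distinct and not
-- all-agreeing, so k ≤ 2^(N-1) - 1, and the columns realising all other patterns
-- attain this.
module Submission where

open import Defs
open import Data.Nat using (ℕ; _≤_; _+_; _∸_; _^_)
open import Data.Product using (_×_; ∃)
open import Relation.Binary.PropositionalEquality using (_≡_)

open import Data.Nat using (zero; suc; pred; z≤n; s≤s; _<_)
open import Data.Nat.Properties
  using (m≤n⇒m<n∨m≡n; <⇒≤pred; m≤pred[n]⇒suc[m]≤n; pred[m∸n]≡m∸[1+n]; m^n≢0; suc-injective)
open import Data.Fin using (Fin; suc; toℕ; fromℕ<; punchIn; combine; funToFin; finToFun)
open import Data.Fin.Patterns using (0F; 1F)
open import Data.Fin.Properties
  using (_≟_; all?; any?; injective⇒≤; toℕ-injective; fromℕ<-injective; toℕ-fromℕ<; toℕ-↑ˡ;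
         toℕ<n; punchIn-injective; punchInᵢ≢i; finToFun-funToFin; funToFin-finToFin)
open import Data.Maybe using (Maybe; just; nothing; map)
open import Data.Maybe.Properties using (just-injective) renaming (≡-dec to ≡-dec-Maybe)
open import Data.Product using (_,_; proj₁; proj₂)
open import Data.Product.Properties using () renaming (≡-dec to ≡-dec-×)
open import Data.Sum using (inj₁; inj₂)
open import Data.Unit using (tt)
open import Data.Empty using (⊥-elim)
open import Function using (_∘_; id; Injective)
open import Relation.Nullary using (Dec; yes; no; ¬_; contradiction)
open import Relation.Nullary.Decidable using (map′; _×-dec_; _→-dec_)
open import Relation.Binary using (DecidableEquality)
open import Relation.Binary.PropositionalEquality
  using (_≢_; _≗_; refl; sym; trans; cong; cong₂; subst)

private
  variable
    S S′ : Set
    m n N k v : ℕ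

funToFin-cong : {f g : Fin m → Fin n} → f ≗ g → funToFin f ≡ funToFin g
funToFin-cong {zero}  e = refl
funToFin-cong {suc m} e = cong₂ combine (e 0F) (funToFin-cong (e ∘ suc))

funToFin-injective : {f g : Fin m → Fin n} → funToFin f ≡ funToFin g → f ≗ g
funToFin-injective {f = f} {g} e i =
  trans (sym (finToFun-funToFin f i)) (trans (cong (λ c → finToFun c i) e) (finToFun-funToFin g i))

finToFun-≗⇒≡ : ∀ {m n} {c : Fin (n ^ m)} {f : Fin m → Fin n} → finToFun c ≗ f → c ≡ funToFin f
finToFun-≗⇒≡ {m} {n} {c} e = trans (sym (funToFin-finToFin {m} {n} c)) (funToFin-cong e)

finToFun-injective : ∀ {m n} {c d : Fin (n ^ m)} → finToFun {n} {m} c ≗ finToFun d → c ≡ d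
finToFun-injective {m} {n} {d = d} e = trans (finToFun-≗⇒≡ {m} {n} e) (funToFin-finToFin {m} {n} d)

toℕ-funToFin-0F : ∀ m → toℕ (funToFin {m} {suc n} λ _ → 0F) ≡ 0
toℕ-funToFin-0F         zero    = refl
toℕ-funToFin-0F {n = n} (suc m) =
  trans (toℕ-↑ˡ (funToFin {m} {suc n} λ _ → 0F) _) (toℕ-funToFin-0F m)

Exhaustible : Set → Set₁
Exhaustible S = ∀ {P : S → Set} → (∀ a → Dec (P a)) → Dec (∀ a → P a)

exhaustible-× : Exhaustible S → Exhaustible S′ → Exhaustible (S × S′)
exhaustible-× ∀S? ∀S′? P? =
  map′ (λ f (a , b) → f a b) (λ f a b → f (a , b)) (∀S? λ a → ∀S′? λ b → P? (a , b))

exhaustible-Maybe : Exhaustible S → Exhaustible (Maybe S)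
exhaustible-Maybe ∀S? P? =
  map′ (λ { (pn , pj) nothing → pn ; (pn , pj) (just a) → pj a }) (λ f → f nothing , f ∘ just)
       (P? nothing ×-dec ∀S? (P? ∘ just))

greatest-below : {P : ℕ → Set} → (∀ n → Dec (P n)) → P 0 → ∀ n →
                 ∃ λ k → P k × (∀ m → m ≤ n → P m → m ≤ k)
greatest-below P? p₀ zero = 0 , p₀ , λ { _ z≤n _ → z≤n }
greatest-below {P} P? p₀ (suc n) with P? (suc n) | greatest-below P? p₀ n
... | yes p  | _             = suc n , p , λ _ m≤1+n _ → m≤1+n
... | no ¬p  | k , pk , maxₖ = k , pk , below-k
  where
  below-k : ∀ m → m ≤ suc n → P m → m ≤ k
  below-k m m≤1+n pm with m≤n⇒m<n∨m≡n m≤1+n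
  ... | inj₁ (s≤s m≤n) = maxₖ m m≤n pm
  ... | inj₂ refl      = contradiction pm ¬p

Locating : Variant → Array N k v → Set
Locating {k = k} {v = v} X A =
  (T₁ T₂ : Cand X k v) → SameRows (ρC X A T₁) (ρC X A T₂) → T₁ ≡ T₂

IsLA-intro : ∀ X {A : Array N k v} → Locating X A → IsLA X A
IsLA-intro X loc T₁ T₂ = loc T₁ T₂ , λ { refl r → id , id }

IsLA⇒Locating : ∀ X {A : Array N k v} → IsLA X A → Locating X A
IsLA⇒Locating X h T₁ T₂ = proj₁ (h T₁ T₂)

IsLA⇒Locating-v11 : ∀ X {A : Array N k v} → IsLA X A → Locating v11 A
IsLA⇒Locating-v11 v11 h t₁ t₂ s = proj₁ (h t₁ t₂) s
IsLA⇒Locating-v11 vb1 h t₁ t₂ s = just-injective (proj₁ (h (just t₁) (just t₂)) s)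
IsLA⇒Locating-v11 v1b h t₁ t₂ s = just-injective (proj₁ (h (just t₁) (just t₂)) s)
IsLA⇒Locating-v11 vbb h t₁ t₂ s =
  just-injective (just-injective (proj₁ (h (just (just t₁)) (just (just t₂))) s))

SameRows-empty : {P Q : RowSet N} → (∀ r → ¬ P r) → (∀ r → ¬ Q r) → SameRows P Q
SameRows-empty ¬P ¬Q r = ⊥-elim ∘ ¬P r , ⊥-elim ∘ ¬Q r

noColumns-v11 : LAExists v11 N 0 v
noColumns-v11 = (λ _ ()) , IsLA-intro v11 λ { (() , _) }

noColumns-vb1 : LAExists vb1 N 0 v
noColumns-vb1 = (λ _ ()) , IsLA-intro vb1 λ where
  nothing nothing _ → refl
  nothing (just (() , _))
  (just (() , _))

Constant : Array N k v → Fin k → Fin v → Set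
Constant A γ σ = ∀ r → A r γ ≡ σ

NoConstantColumn : Array N k v → Set
NoConstantColumn A = ∀ γ σ → ¬ Constant A γ σ

constant⇒ρ₁-empty : ∀ {A : Array N k v} {γ σ σ′} →
                    Constant A γ σ → σ′ ≢ σ → ∀ r → ¬ ρ₁ A (γ , σ′) r
constant⇒ρ₁-empty c σ′≢σ r eq = σ′≢σ (trans (sym eq) (c r))

v11-noConstantColumn : {A : Array N k (suc (suc (suc v)))} →
                       Locating v11 A → NoConstantColumn A
v11-noConstantColumn {A = A} loc γ σ c = contradiction
  (punchIn-injective σ 0F 1F (cong proj₂ (loc (γ , punchIn σ 0F) (γ , punchIn σ 1F)
    (SameRows-empty (empty 0F) (empty 1F))))) λ ()
  where
  empty : ∀ i r → ¬ ρ₁ A (γ , punchIn σ i) r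
  empty i = constant⇒ρ₁-empty {A = A} c (punchInᵢ≢i σ i)

vb1-noConstantColumn : {A : Array N k (suc (suc v))} → IsLA vb1 A → NoConstantColumn A
vb1-noConstantColumn {A = A} h γ σ c with () ← IsLA⇒Locating vb1 h nothing (just (γ , punchIn σ 0F))
  (SameRows-empty (λ _ ()) (constant⇒ρ₁-empty {A = A} c (punchInᵢ≢i σ 0F)))

v1b-noConstantColumn : {A : Array N k v} → IsLA v1b A → NoConstantColumn A
v1b-noConstantColumn h γ σ c with () ← IsLA⇒Locating v1b h nothing (just (γ , σ))
  (λ r → (λ _ → c r) , _)

v1b-intro : {A : Array N k v} → Locating v11 A → NoConstantColumn A → IsLA v1b A
v1b-intro loc nc = IsLA-intro v1b λ where
  nothing        nothing        _ → refl
  nothing        (just (γ , σ)) s → ⊥-elim (nc γ σ λ r → proj₁ (s r) tt)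
  (just (γ , σ)) nothing        s → ⊥-elim (nc γ σ λ r → proj₂ (s r) tt)
  (just t₁)      (just t₂)      s → cong just (loc t₁ t₂ s)

vbb-intro : {A : Array (suc N) k v} → IsLA vb1 A → NoConstantColumn A → IsLA vbb A
vbb-intro h nc = IsLA-intro vbb λ where
    nothing               nothing               _ → refl
    nothing               (just nothing)        s → ⊥-elim (proj₂ (s 0F) tt)
    (just nothing)        nothing               s → ⊥-elim (proj₁ (s 0F) tt)
    (just nothing)        (just nothing)        _ → refl
    (just nothing)        (just (just (γ , σ))) s → ⊥-elim (nc γ σ λ r → proj₁ (s r) tt)
    (just (just (γ , σ))) (just nothing)        s → ⊥-elim (nc γ σ λ r → proj₂ (s r) tt)
    nothing               (just (just t))       s → cong (map just) (loc nothing (just t) s)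
    (just (just t))       nothing               s → cong (map just) (loc (just t) nothing s)
    (just (just t₁))      (just (just t₂))      s → cong (map just) (loc (just t₁) (just t₂) s)
  where loc = IsLA⇒Locating vb1 h

v11⇒v1b : {A : Array N k (suc (suc (suc v)))} → IsLA v11 A → IsLA v1b A
v11⇒v1b h = v1b-intro loc (v11-noConstantColumn loc)
  where loc = IsLA⇒Locating-v11 v11 h

v1b⇒v11 : {A : Array N k v} → IsLA v1b A → IsLA v11 A
v1b⇒v11 = IsLA-intro v11 ∘ IsLA⇒Locating-v11 v1b

vb1⇒vbb : {A : Array (suc N) k (suc (suc v))} → IsLA vb1 A → IsLA vbb A
vb1⇒vbb h = vbb-intro h (vb1-noConstantColumn h)

vbb⇒vb1 : {A : Array N k v} → IsLA vbb A → IsLA vb1 A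
vbb⇒vb1 h = IsLA-intro vb1 λ where
    nothing   nothing   _ → refl
    nothing   (just t)  s → contradiction (loc nothing (just (just t)) s) λ ()
    (just t)  nothing   s → contradiction (loc (just (just t)) nothing s) λ ()
    (just t₁) (just t₂) s → cong just (IsLA⇒Locating-v11 vbb h t₁ t₂ s)
  where loc = IsLA⇒Locating vbb h

exhaustible-Cand : ∀ X → Exhaustible (Cand X k v)
exhaustible-Cand v11 = exhaustible-× all? all?
exhaustible-Cand vb1 = exhaustible-Maybe (exhaustible-× all? all?)
exhaustible-Cand v1b = exhaustible-Maybe (exhaustible-× all? all?)
exhaustible-Cand vbb = exhaustible-Maybe (exhaustible-Maybe (exhaustible-× all? all?))

≡-dec-Cand : ∀ X → DecidableEquality (Cand X k v)
≡-dec-Cand v11 = ≡-dec-× _≟_ _≟_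
≡-dec-Cand vb1 = ≡-dec-Maybe (≡-dec-× _≟_ _≟_)
≡-dec-Cand v1b = ≡-dec-Maybe (≡-dec-× _≟_ _≟_)
≡-dec-Cand vbb = ≡-dec-Maybe (≡-dec-Maybe (≡-dec-× _≟_ _≟_))

ρI? : (A : Array N k v) → ∀ T r → Dec (ρI A T r)
ρI? A nothing        r = yes tt
ρI? A (just (γ , σ)) r = A r γ ≟ σ

ρC? : ∀ X (A : Array N k v) T r → Dec (ρC X A T r)
ρC? v11 A t        = ρI? A (just t)
ρC? vb1 A nothing  = λ _ → no λ ()
ρC? vb1 A (just t) = ρI? A (just t)
ρC? v1b A T        = ρI? A T
ρC? vbb A nothing  = λ _ → no λ ()
ρC? vbb A (just T) = ρI? A T

SameRows? : {P Q : RowSet N} → (∀ r → Dec (P r)) → (∀ r → Dec (Q r)) → Dec (SameRows P Q)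
SameRows? P? Q? = all? λ r → (P? r →-dec Q? r) ×-dec (Q? r →-dec P? r)

IsLA? : ∀ X (A : Array N k v) → Dec (IsLA X A)
IsLA? X A = map′ (IsLA-intro X) (IsLA⇒Locating X)
  (∀? λ T₁ → ∀? λ T₂ → SameRows? (ρC? X A T₁) (ρC? X A T₂) →-dec ≡-dec-Cand X T₁ T₂)
  where ∀? = exhaustible-Cand X

ρI-resp : {A B : Array N k v} → (∀ r γ → A r γ ≡ B r γ) → ∀ T r → ρI A T r → ρI B T r
ρI-resp A≈B nothing        r = id
ρI-resp A≈B (just (γ , σ)) r = trans (sym (A≈B r γ))

ρC-resp : ∀ X {A B : Array N k v} → (∀ r γ → A r γ ≡ B r γ) → ∀ T r → ρC X A T r → ρC X B T r
ρC-resp v11 A≈B t        = ρI-resp A≈B (just t)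
ρC-resp vb1 A≈B nothing  = λ _ ()
ρC-resp vb1 A≈B (just t) = ρI-resp A≈B (just t)
ρC-resp v1b A≈B T        = ρI-resp A≈B T
ρC-resp vbb A≈B nothing  = λ _ ()
ρC-resp vbb A≈B (just T) = ρI-resp A≈B T

Locating-resp : ∀ X {A B : Array N k v} → (∀ r γ → A r γ ≡ B r γ) → Locating X A → Locating X B
Locating-resp X A≈B loc T₁ T₂ s = loc T₁ T₂ λ r →
    ρC-resp X B≈A T₂ r ∘ proj₁ (s r) ∘ ρC-resp X A≈B T₁ r
  , ρC-resp X B≈A T₁ r ∘ proj₂ (s r) ∘ ρC-resp X A≈B T₂ r
  where B≈A = λ r γ → sym (A≈B r γ)

encode : Array N k v → Fin ((v ^ N) ^ k)
encode A = funToFin λ γ → funToFin λ r → A r γ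

decode : Fin ((v ^ N) ^ k) → Array N k v
decode c r γ = finToFun (finToFun c γ) r

decode-encode : (A : Array N k v) → ∀ r γ → decode (encode A) r γ ≡ A r γ
decode-encode A r γ =
  trans (cong (λ c → finToFun c r) (finToFun-funToFin _ γ)) (finToFun-funToFin _ r)

LAExists? : ∀ X N k v → Dec (LAExists X N k v)
LAExists? X N k v = map′ (λ (c , h) → decode c , h)
  (λ (A , h) → encode A , IsLA-intro X
     (Locating-resp X (λ r γ → sym (decode-encode A r γ)) (IsLA⇒Locating X h)))
  (any? λ c → IsLA? X (decode c))

-- Distinct columns have distinct sets of rows carrying symbol 0.
columns≤ : ∀ X → LAExists X N k (suc v) → k ≤ suc v ^ N
columns≤ X (A , h) = injective⇒≤ {f = column} λ {γ} {γ′} e →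
  let same = funToFin-injective e in
  cong proj₁ (IsLA⇒Locating-v11 X h (γ , 0F) (γ′ , 0F) λ r → trans (sym (same r)) , trans (same r))
  where column = λ γ → funToFin λ r → A r γ

LAK-exists : ∀ X N v → LAExists X N 0 (suc v) → ∃ (IsLAK X N (suc v))
LAK-exists X N v e₀ =
  let k , eₖ , maxₖ = greatest-below (λ k → LAExists? X N k (suc v)) e₀ (suc v ^ N)
  in k , eₖ , λ k′ e′ → maxₖ k′ (columns≤ X e′) e′

IsLAK-transfer : ∀ X Y → (∀ {k} {A : Array N k v} → IsLA X A → IsLA Y A) →
                 (∀ {k} {A : Array N k v} → IsLA Y A → IsLA X A) →
                 IsLAK X N v k → IsLAK Y N v k
IsLAK-transfer X Y to from ((A , h) , maxₖ) = (A , to h) , λ k′ (B , hB) → maxₖ k′ (B , from hB)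

v1b-LAK≡v11-LAK : ∀ N → 3 ≤ v → ∃ λ k → IsLAK v1b N v k × IsLAK v11 N v k
v1b-LAK≡v11-LAK N (s≤s (s≤s (s≤s _))) =
  let k , lak = LAK-exists v11 N _ noColumns-v11
  in k , IsLAK-transfer v11 v1b v11⇒v1b v1b⇒v11 lak , lak

vbb-LAK≡vb1-LAK : 2 ≤ v → v ≤ N → ∃ λ k → IsLAK vbb N v k × IsLAK vb1 N v k
vbb-LAK≡vb1-LAK {N = N} (s≤s (s≤s _)) (s≤s _) =
  let k , lak = LAK-exists vb1 N _ noColumns-vb1
  in k , IsLAK-transfer vb1 vbb vb1⇒vbb vbb⇒vb1 lak , lak

indicator : {P : Set} → Dec P → Fin 2
indicator (yes _) = 0F
indicator (no _)  = 1F

indicator-≡ : {P Q : Set} (p? : Dec P) (q? : Dec Q) → indicator p? ≡ indicator q? → P → Q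
indicator-≡ _       (yes q) _  _ = q
indicator-≡ (no ¬p) _       _  p = ⊥-elim (¬p p)
indicator-≡ (yes _) (no _)  () _

agreement⇒≡ : (a b σ : Fin 2) → (a ≡ σ → b ≡ σ) → (b ≡ σ → a ≡ σ) → a ≡ b
agreement⇒≡ 0F 0F _  _  _    = refl
agreement⇒≡ 1F 1F _  _  _    = refl
agreement⇒≡ 0F 1F 0F to _    = contradiction (to refl) λ ()
agreement⇒≡ 0F 1F 1F _  from = contradiction (from refl) λ ()
agreement⇒≡ 1F 0F 0F _  from = contradiction (from refl) λ ()
agreement⇒≡ 1F 0F 1F to _    = contradiction (to refl) λ ()

pred≡∸1 : ∀ n → pred n ≡ n ∸ 1
pred≡∸1 n = pred[m∸n]≡m∸[1+n] n 0

v1b-columns≤ : ∀ {M} → LAExists v1b (suc M) k 2 → k ≤ 2 ^ M ∸ 1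
v1b-columns≤ {k} {M} (A , h) =
  subst (k ≤_) (pred≡∸1 (2 ^ M)) (<⇒≤pred (injective⇒≤ {f = code} code-injective))
  where
  agreesWithRow0 : Fin k → Fin M → Fin 2
  agreesWithRow0 γ i = indicator (A (suc i) γ ≟ A 0F γ)

  -- The all-agreeing word 0…0 is reserved for the extra point 0F.
  code : Fin (suc k) → Fin (2 ^ M)
  code 0F      = funToFin {M} λ _ → 0F
  code (suc γ) = funToFin (agreesWithRow0 γ)

  constant : ∀ γ → agreesWithRow0 γ ≗ (λ _ → 0F) → Constant A γ (A 0F γ)
  constant γ e 0F      = refl
  constant γ e (suc i) = indicator-≡ (yes tt) (A (suc i) γ ≟ A 0F γ) (sym (e i)) tt

  same-rows : ∀ {γ γ′} → agreesWithRow0 γ ≗ agreesWithRow0 γ′ →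
              SameRows (ρ₁ A (γ , A 0F γ)) (ρ₁ A (γ′ , A 0F γ′))
  same-rows e 0F      = (λ _ → refl) , (λ _ → refl)
  same-rows e (suc i) = indicator-≡ _ _ (e i) , indicator-≡ _ _ (sym (e i))

  code-injective : Injective _≡_ _≡_ code
  code-injective {0F}    {0F}     _ = refl
  code-injective {0F}    {suc γ}  e =
    ⊥-elim (v1b-noConstantColumn h γ _ (constant γ (sym ∘ funToFin-injective e)))
  code-injective {suc γ} {0F}     e =
    ⊥-elim (v1b-noConstantColumn h γ _ (constant γ (funToFin-injective e)))
  code-injective {suc γ} {suc γ′} e =
    cong (suc ∘ proj₁) (IsLA⇒Locating-v11 v1b h _ _ (same-rows (funToFin-injective e)))

-- Column γ is 0 above the binary word γ + 1, so the columns run through all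
-- nonzero words.
module BinaryLA (M : ℕ) where

  code-bound : (γ : Fin (2 ^ M ∸ 1)) → suc (toℕ γ) < 2 ^ M
  code-bound γ = m≤pred[n]⇒suc[m]≤n {{m^n≢0 2 M}}
    (subst (toℕ γ <_) (sym (pred≡∸1 (2 ^ M))) (toℕ<n γ))

  code : Fin (2 ^ M ∸ 1) → Fin (2 ^ M)
  code γ = fromℕ< (code-bound γ)

  bits : Fin (2 ^ M) → Fin M → Fin 2
  bits = finToFun

  A : Array (suc M) (2 ^ M ∸ 1) 2
  A 0F      γ = 0F
  A (suc i) γ = bits (code γ) i

  bits-code-injective : ∀ {γ γ′} → bits (code γ) ≗ bits (code γ′) → γ ≡ γ′
  bits-code-injective e = toℕ-injective (suc-injective
    (fromℕ<-injective _ _ _ _ (finToFun-injective {M} {2} e)))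

  noConstantColumn : NoConstantColumn A
  noConstantColumn γ σ c with () ←
    trans (sym (toℕ-fromℕ< (code-bound γ)))
      (trans (cong toℕ (finToFun-≗⇒≡ {M} {2} λ i → trans (c (suc i)) (sym (c 0F))))
             (toℕ-funToFin-0F M))

  same-symbol : ∀ {γ σ γ′ σ′} → SameRows (ρ₁ A (γ , σ)) (ρ₁ A (γ′ , σ′)) → σ ≡ σ′
  same-symbol s = agreement⇒≡ _ _ 0F (sym ∘ proj₁ (s 0F) ∘ sym) (sym ∘ proj₂ (s 0F) ∘ sym)

  locating-v11 : Locating v11 A
  locating-v11 (γ , σ) (γ′ , σ′) s with refl ← same-symbol s = cong (_, σ)
    (bits-code-injective λ i → agreement⇒≡ _ _ σ (proj₁ (s (suc i))) (proj₂ (s (suc i))))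

v1b-LAK-binary : ∀ M → IsLAK v1b (suc M) 2 (2 ^ M ∸ 1)
v1b-LAK-binary M = (A , v1b-intro locating-v11 noConstantColumn) , λ _ → v1b-columns≤
  where open BinaryLA M

theorem6p2 : (N v : ℕ) → 2 ≤ v → v ≤ N + 1 →
    (3 ≤ v → ∃ λ k → IsLAK v1b N v k × IsLAK v11 N v k)
  × (v ≡ 2 → IsLAK v1b N 2 (2 ^ (N ∸ 1) ∸ 1))
  × (v ≤ N → ∃ λ k → IsLAK vbb N v k × IsLAK vb1 N v k)
theorem6p2 zero    v (s≤s (s≤s _)) (s≤s ())
theorem6p2 (suc M) v 2≤v           _        =
  v1b-LAK≡v11-LAK (suc M) , (λ { refl → v1b-LAK-binary M }) , vbb-LAK≡vb1-LAK 2≤v
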